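{- Let $T$ be a based scheme on $X$ (basepoint $x_*$), $U$ a based scheme on $Y$ (basepoint $y_*$), $\zeta$ an action of $U$ on $T$, $\tilde T=\{[1_Y,t]:t\in T\}\subseteq U\ltimes_\zeta T$, and $i:U\to U\ltimes_\zeta T$ the morphism of schemes given on points by $y\mapsto (y,x_*)$, so that $ui$ denotes the element of $U\ltimes_\zeta T$ containing the images of the pairs in $u$. Then for each $u\in U$ and each $\tilde t\in\tilde T$, $|(ui)\tilde t|=|\tilde t(ui)|=1$, where products are complex products in $U\ltimes_\zeta T$.
   Context: All schemes are association schemes on finite sets. Complex product $pq=\{r:a_{pqr}>0\}$; closed: $T^*T\subseteq T$; normal: $pT=Tp$ for all $p$. For closed $T$: $xT=\bigcup_{t\in T}xt$, $X/T=\{xT\}$, $s^T=\{(x_1T,x_2T):(x_1',x_2')\in s$ for some $x_i'\in x_iT\}$, $S/\!\!/T=\{s^T\}$. A morphism of schemes is a map of underlying sets sending pairs in a common relation to pairs in a common relation; it induces a map on relations; isomorphism if both are bijective. Based schemes carry a basepoint; based morphisms preserve it. Category $\mathcal C$: for based $T$ on $X$, $U$ on $Y$, $\phi\in\mathrm{Hom}_{\mathcal C}(T,U)$ is $(T_\phi,U_\phi,\tilde\phi)$, $T_\phi,U_\phi$ normal closed in $T,U$, $\tilde\phi:T/\!\!/T_\phi\to U/\!\!/U_\phi$ a based isomorphism. Composition with $\psi\in\mathrm{Hom}_{\mathcal C}(U,V)$ ($V$ on $W$): $T_{\phi\psi}=\{t:\exists u,\ t^{T_\phi}\tilde\phi=u^{U_\phi},\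 u^{U_\psi}\tilde\psi=1_W^{V_\psi}\}$, $V_{\phi\psi}=\{v:\exists u,\ 1_X^{T_\phi}\tilde\phi=u^{U_\phi},\ u^{U_\psi}\tilde\psi=v^{V_\psi}\}$, $(xT_{\phi\psi})\widetilde{\phi\psi}=wV_{\phi\psi}$ where $(xT_\phi)\tilde\phi=yU_\phi$, $(yU_\psi)\tilde\psi=wV_\psi$. $\mathrm{id}_T=(\{1_X\},\{1_X\},\mathrm{id})$. $\phi\le\psi$: $T_\phi\subseteq T_\psi$, $U_\phi\subseteq U_\psi$, $(xT_\phi)\tilde\phi\subseteq(xT_\psi)\tilde\psi$ for all $x$. $\phi^*\in\mathrm{Hom}_{\mathcal C}(U,T)$: same subsets, isomorphism $\tilde\phi^{ -1}$. $\tau=\tau_T$: the set $T$ with involution, distinguished $1=1_X$, constants $a_{pqr}$. A $\tau$-scheme: $(T',\alpha)$, $\alpha:\tau\to T'$ bijective, $1\alpha$ diagonal, $(p^*)\alpha=(p\alpha)^*$, $a_{(p\alpha)(q\alpha)(r\alpha)}=a_{pqr}$. For $\tau$-schemes $(T_1,\alpha),(T_2,\beta)$, $\phi\in\mathrm{Hom}_{\mathcal C}(T_1,T_2)$: $\phi(\tau)(P)=\{u:(t\alpha)^{(T_1)_\phi}\tilde\phi=(u\beta)^{(T_2)_\phi}$ for some $t\in P\}$. Action $\zeta$ of $U$ on $T$: $\tau$-schemes $\zeta_y=(T_y,\alpha^y)$ on $X$ ($y\in Y$) and $\zeta_{y_1}^{y_2}\in\mathrm{Hom}_{\mathcal C}(T_{y_1},T_{y_2})$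 with (1) $T_{y_*}=T$, $\alpha^{y_*}=\mathrm{id}$; (2) $\zeta_y^y=\mathrm{id}$; (3) $\zeta_{y_2}^{y_1}=(\zeta_{y_1}^{y_2})^*$; (4) $\zeta_{y_1}^{y_2}(\tau)$ depends only on the $u\in U$ containing $(y_1,y_2)$; (5) $\zeta_{y_1}^{y_3}\le\zeta_{y_1}^{y_2}\zeta_{y_2}^{y_3}$. $T'_{y_1y_2}=(T_{y_1})_{\zeta_{y_1}^{y_2}}$, $T''_{y_1y_2}=(T_{y_2})_{\zeta_{y_1}^{y_2}}$. $[u,t]$ is the set of $((y_1,x_1),(y_2,x_2))$ with $(y_1,y_2)\in u$ and $((x_1T'_{y_1y_2})\tilde\zeta_{y_1}^{y_2},x_2T''_{y_1y_2})\in(t\alpha^{y_2})^{T''_{y_1y_2}}$; $U\ltimes_\zeta T=\{[u,t]\}$, a scheme on $Y\times X$ based at $(y_*,x_*)$. -}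

module Defs where

open import Data.Nat using (ℕ; zero; suc; _+_; _<_)
open import Data.Fin using (Fin; zero; suc; _≟_)
open import Data.Bool using (Bool; true; false; if_then_else_; _∧_)
open import Data.Product using (Σ; ∃; ∃-syntax; _×_; _,_; proj₁; proj₂)
open import Relation.Nullary.Decidable using (⌊_⌋)
open import Relation.Binary.PropositionalEquality using (_≡_)
open import Function using (_∘_)
open import Function.Bundles using (_⇔_)
open import Function.Definitions using (Bijective)
open import Level using (0ℓ)
open import Relation.Unary using (Pred; _∈_)

count : ∀ {n} → (Fin n → Bool) → ℕ
count {zero}  f = 0
count {suc n} f = (if f zero then 1 else 0) + count (f ∘ suc)

-- The relations are labelled by
-- Fin m : 'rel x y' is the (unique) relation containing (x , y).
-- Distinct labels denote distinct relations (every label is used).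

record Scheme (n m : ℕ) : Set where
  field
    rel      : Fin n → Fin n → Fin m
    rel-surj : ∀ (s : Fin m) → ∃[ x ] ∃[ y ] rel x y ≡ s
    one      : Fin m
    one-diag : ∀ x y → (rel x y ≡ one) ⇔ (x ≡ y)
    inv      : Fin m → Fin m
    inv-spec : ∀ x y → rel y x ≡ inv (rel x y)
    -- intersection numbers are well defined
    regular  : ∀ (p q : Fin m) x y x' y' → rel x y ≡ rel x' y' →
               count (λ z → ⌊ rel x z ≟ p ⌋ ∧ ⌊ rel z y ≟ q ⌋)
                 ≡ count (λ z → ⌊ rel x' z ≟ p ⌋ ∧ ⌊ rel z y' ≟ q ⌋)

open Scheme public

module _ {n m : ℕ} (S : Scheme n m) where

  -- number of z with (x,z) ∈ p, (z,y) ∈ q  (= a_{pqr} for r ∋ (x,y))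
  interNum : Fin m → Fin m → Fin n → Fin n → ℕ
  interNum p q x y = count (λ z → ⌊ rel S x z ≟ p ⌋ ∧ ⌊ rel S z y ≟ q ⌋)

  InProd : Fin m → Fin m → Fin m → Set
  InProd p q r = ∃[ x ] ∃[ y ] (rel S x y ≡ r × 0 < interNum p q x y)

  -- closed subsets (nonempty, T* T ⊆ T) that are normal (pT = Tp)
  record NormalClosed : Set₁ where
    field
      mem      : Pred (Fin m) 0ℓ
      nonempty : ∃[ t ] mem t
      closed   : ∀ p q r → mem p → mem q → InProd (inv S p) q r → mem r
      normal   : ∀ p r → (∃[ t ] (mem t × InProd p t r))
                           ⇔ (∃[ t ] (mem t × InProd t p r))
  open NormalClosed public

  module _ (N : NormalClosed) where
    InCoset : Fin n → Fin n → Set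
    InCoset x z = mem N (rel S x z)

    SameCoset : Fin n → Fin n → Set
    SameCoset x x' = ∀ z → InCoset x z ⇔ InCoset x' z

    QRel : Fin m → Fin n → Fin n → Set
    QRel s a b = ∃[ a' ] ∃[ b' ] (InCoset a a' × InCoset b b' × rel S a' b' ≡ s)

    QEq : Fin m → Fin m → Set
    QEq s s' = ∀ a b → QRel s a b ⇔ QRel s' a b

    QCommon : Fin n → Fin n → Fin n → Fin n → Set
    QCommon a b c d = ∃[ s ] (QRel s a b × QRel s c d)

-- Based isomorphisms S//N → S'//N' ; the map on X/N is given by a map
-- f on representatives (xN)φ̃ = (f x)N'.

module _ {n m n' m' : ℕ} (S : Scheme n m) (x₀ : Fin n)
         (S' : Scheme n' m') (y₀ : Fin n')
         (N : NormalClosed S) (N' : NormalClosed S') where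

  ImgRel : (Fin n → Fin n') → Fin m → Fin m' → Set
  ImgRel f s u = ∀ a b → QRel S N s a b → QRel S' N' u (f a) (f b)

  record QIso : Set₁ where
    field
      fun      : Fin n → Fin n'
      resp     : ∀ a a' → SameCoset S N a a' → SameCoset S' N' (fun a) (fun a')
      inj      : ∀ a a' → SameCoset S' N' (fun a) (fun a') → SameCoset S N a a'
      surj     : ∀ b → ∃[ a ] SameCoset S' N' (fun a) b
      based    : SameCoset S' N' (fun x₀) y₀
      hom      : ∀ a b c d → QCommon S N a b c d →
                 QCommon S' N' (fun a) (fun b) (fun c) (fun d)
      rel-inj  : ∀ s₁ s₂ u → ImgRel fun s₁ u → ImgRel fun s₂ u → QEq S N s₁ s₂
      rel-surj : ∀ u → ∃[ s ] ImgRel fun s u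
  open QIso public

record Hom {n m n' m' : ℕ} (S : Scheme n m) (x₀ : Fin n)
           (S' : Scheme n' m') (y₀ : Fin n') : Set₁ where
  field
    src : NormalClosed S
    tgt : NormalClosed S'
    iso : QIso S x₀ S' y₀ src tgt
open Hom public

mapH : ∀ {n m n' m'} {S : Scheme n m} {x₀ : Fin n} {S' : Scheme n' m'}
       {y₀ : Fin n'} → Hom S x₀ S' y₀ → Fin n → Fin n'
mapH φ = fun (iso φ)

ImgH : ∀ {n m n' m'} {S : Scheme n m} {x₀ : Fin n} {S' : Scheme n' m'}
       {y₀ : Fin n'} → Hom S x₀ S' y₀ → Fin m → Fin m' → Set
ImgH {S = S} {x₀} {S'} {y₀} φ = ImgRel S x₀ S' y₀ (src φ) (tgt φ) (mapH φ)

IsId : ∀ {n m} {S : Scheme n m} {x₀ : Fin n} → Hom S x₀ S x₀ → Set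
IsId {S = S} φ =
  (∀ t → mem (src φ) t ⇔ (t ≡ one S)) ×
  (∀ t → mem (tgt φ) t ⇔ (t ≡ one S)) ×
  (∀ x → SameCoset S (tgt φ) (mapH φ x) x)

IsStar : ∀ {n m n' m'} {S : Scheme n m} {x₀ : Fin n} {S' : Scheme n' m'}
         {y₀ : Fin n'} → Hom S x₀ S' y₀ → Hom S' y₀ S x₀ → Set
IsStar {S = S} {S' = S'} φ ψ =
  (∀ u → mem (src ψ) u ⇔ mem (tgt φ) u) ×
  (∀ t → mem (tgt ψ) t ⇔ mem (src φ) t) ×
  (∀ y → SameCoset S' (tgt φ) (mapH φ (mapH ψ y)) y)

LeComp : ∀ {n₁ m₁ n₂ m₂ n₃ m₃}
         {S₁ : Scheme n₁ m₁} {x₁ : Fin n₁} {S₂ : Scheme n₂ m₂} {x₂ : Fin n₂}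
         {S₃ : Scheme n₃ m₃} {x₃ : Fin n₃} →
         Hom S₁ x₁ S₃ x₃ → Hom S₁ x₁ S₂ x₂ → Hom S₂ x₂ S₃ x₃ → Set
LeComp {m₂ = m₂} {S₁ = S₁} {S₃ = S₃} φ ψ χ =
  (∀ t → mem (src φ) t → CompSrc t) ×
  (∀ v → mem (tgt φ) v → CompTgt v) ×
  (∀ x z → InCoset S₃ (tgt φ) (mapH φ x) z →
           rel S₃ (mapH χ (mapH ψ x)) z ∈ CompTgt)
  where
    CompSrc : Pred _ 0ℓ
    CompSrc t = ∃[ u ] (ImgH ψ t u × ImgH χ u (one S₃))
    CompTgt : Pred _ 0ℓ
    CompTgt v = ∃[ u ] (ImgH ψ (one S₁) u × ImgH χ u v)

record TauScheme {n m : ℕ} (T : Scheme n m) : Set where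
  field
    m'     : ℕ
    sch    : Scheme n m'
    α      : Fin m → Fin m'
    α-bij  : Bijective _≡_ _≡_ α
    α-one  : α (one T) ≡ one sch
    α-inv  : ∀ p → α (inv T p) ≡ inv sch (α p)
    α-int  : ∀ p q x y x' y' → rel sch x' y' ≡ α (rel T x y) →
             interNum sch (α p) (α q) x' y' ≡ interNum T p q x y
open TauScheme public

HomTau : ∀ {n m} {T : Scheme n m} {x₀ : Fin n} (A B : TauScheme T) →
         Hom (sch A) x₀ (sch B) x₀ → Pred (Fin m) 0ℓ → Pred (Fin m) 0ℓ
HomTau A B φ P u = ∃[ t ] (t ∈ P × ImgH φ (α A t) (α B u))

record Action {nX mT nY mU : ℕ} (T : Scheme nX mT) (x₀ : Fin nX)
              (U : Scheme nY mU) (y₀ : Fin nY) : Set₁ where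
  field
    ζ    : Fin nY → TauScheme T
    ζhom : ∀ y₁ y₂ → Hom (sch (ζ y₁)) x₀ (sch (ζ y₂)) x₀
    ax1  : ∀ t x x' → (rel T x x' ≡ t) ⇔ (rel (sch (ζ y₀)) x x' ≡ α (ζ y₀) t)
    ax2  : ∀ y → IsId (ζhom y y)
    ax3  : ∀ y₁ y₂ → IsStar (ζhom y₁ y₂) (ζhom y₂ y₁)
    ax4  : ∀ y₁ y₂ y₁' y₂' → rel U y₁ y₂ ≡ rel U y₁' y₂' →
           ∀ (P : Pred (Fin mT) 0ℓ) u →
           HomTau (ζ y₁) (ζ y₂) (ζhom y₁ y₂) P u
             ⇔ HomTau (ζ y₁') (ζ y₂') (ζhom y₁' y₂') P u
    ax5  : ∀ y₁ y₂ y₃ → LeComp (ζhom y₁ y₃) (ζhom y₁ y₂) (ζhom y₂ y₃)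
open Action public

-- The semidirect product U ⋉_ζ T on Y × X; its relations are [u,t],
-- indexed by pairs (u , t).

module _ {nX mT nY mU : ℕ} {T : Scheme nX mT} {x₀ : Fin nX}
         {U : Scheme nY mU} {y₀ : Fin nY} (Z : Action T x₀ U y₀) where

  Pt : Set
  Pt = Fin nY × Fin nX

  Lab : Set
  Lab = Fin mU × Fin mT

  InSD : Lab → Pt → Pt → Set
  InSD (u , t) (y₁ , x₁) (y₂ , x₂) =
    rel U y₁ y₂ ≡ u ×
    QRel (sch (ζ Z y₂)) (tgt (ζhom Z y₁ y₂)) (α (ζ Z y₂) t)
         (mapH (ζhom Z y₁ y₂) x₁) x₂

  SameSD : Lab → Lab → Set
  SameSD r r' = ∀ p q → InSD r p q ⇔ InSD r' p q

  -- r ∈ r₁ r₂  (complex product in U ⋉ T: a_{r₁ r₂ r} > 0)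
  InProdSD : Lab → Lab → Lab → Set
  InProdSD r₁ r₂ r = ∃[ p ] ∃[ q ] (InSD r p q × ∃[ z ] (InSD r₁ p z × InSD r₂ z q))

  Singleton : Pred Lab 0ℓ → Set
  Singleton P = ∃[ r ] (P r × ∀ r' → P r' → SameSD r' r)

  IsImageI : Fin mU → Lab → Set
  IsImageI u r = ∀ y₁ y₂ → rel U y₁ y₂ ≡ u → InSD r (y₁ , x₀) (y₂ , x₀)

-- The pairs of ui are the ((a , x₀) , (c , x₀)) with (a , c) ∈ u, and ui = [u , t₀] with
-- α(t₀) in the target normal closed subset of ζ_a^c for every (a , c) ∈ u.  Hence a
-- relation [w , t'] of (ui)[1 , t] or of [1 , t](ui) has w = u, and, read through one
-- pair (a , c) ∈ u, its label t' corresponds to t (or t to t') under the isomorphism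
-- ζ̃_a^c of quotient schemes.  A quotient relation s^N is determined by any one of its
-- pairs, and by axiom (4) the correspondence ζ_a^c(τ) does not depend on the pair
-- (a , c) ∈ u; so all such [u , t'] coincide.  Nonemptiness is a choice of neighbours.
module Submission where

open import Defs
open import Data.Nat using (ℕ; zero; suc; _<_; z≤n; s≤s)
open import Data.Fin using (Fin; zero; suc; _≟_)
open import Data.Product using (_×_; _,_; proj₁; proj₂; ∃-syntax)
open import Data.Bool using (Bool; true; false; _∧_)
open import Data.Bool.Properties using (T-≡; T-∧)
open import Relation.Nullary.Decidable using (⌊_⌋; toWitness; fromWitness)
open import Relation.Binary.PropositionalEquality
  using (_≡_; refl; sym; trans; cong; cong₂; subst)
open import Function using (_∘_)
open import Function.Bundles using (_⇔_; mk⇔; Equivalence)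

open Equivalence using (to; from)

witness⇒0<count : ∀ {k} (f : Fin k → Bool) z → f z ≡ true → 0 < count f
witness⇒0<count f zero    fz rewrite fz = s≤s z≤n
witness⇒0<count f (suc z) fz with f zero
... | true  = s≤s z≤n
... | false = witness⇒0<count (f ∘ suc) z fz

0<count⇒witness : ∀ {k} (f : Fin k → Bool) → 0 < count f → ∃[ z ] f z ≡ true
0<count⇒witness {zero}  f ()
0<count⇒witness {suc k} f pos with f zero in fzero
... | true  = zero , fzero
... | false with 0<count⇒witness (f ∘ suc) pos
...   | z , fz = suc z , fz

≟∧≟≡true : ∀ {m} {a b c d : Fin m} → (⌊ a ≟ b ⌋ ∧ ⌊ c ≟ d ⌋ ≡ true) ⇔ (a ≡ b × c ≡ d)
≟∧≟≡true {a = a} {b} {c} {d} = mk⇔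
  (λ e → let ab , cd = to (T-∧ {⌊ a ≟ b ⌋}) (from T-≡ e)
         in toWitness {a? = a ≟ b} ab , toWitness {a? = c ≟ d} cd)
  (λ (ab , cd) → to T-≡ (from (T-∧ {⌊ a ≟ b ⌋})
                   (fromWitness {a? = a ≟ b} ab , fromWitness {a? = c ≟ d} cd)))

module SchemeProperties {n m : ℕ} (S : Scheme n m) where

  Path : Fin m → Fin m → Fin n → Fin n → Set
  Path p q x y = ∃[ z ] (rel S x z ≡ p × rel S z y ≡ q)

  0<interNum⇔Path : ∀ p q x y → 0 < interNum S p q x y ⇔ Path p q x y
  0<interNum⇔Path p q x y = mk⇔
    (λ pos → let z , hit = 0<count⇒witness _ pos in z , to ≟∧≟≡true hit)
    (λ (z , xz , zy) → witness⇒0<count _ z (from ≟∧≟≡true (xz , zy)))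

  Path-transfer : ∀ {p q x y x' y'} → rel S x y ≡ rel S x' y' →
                  Path p q x y → Path p q x' y'
  Path-transfer {p} {q} {x} {y} {x'} {y'} e =
    to (0<interNum⇔Path p q x' y')
    ∘ subst (0 <_) (regular S p q x y x' y' e)
    ∘ from (0<interNum⇔Path p q x y)

  inv-involutive : ∀ s → inv S (inv S s) ≡ s
  inv-involutive s with Scheme.rel-surj S s
  ... | x , y , refl = trans (cong (inv S) (sym (inv-spec S x y))) (sym (inv-spec S y x))

  rel-diag : ∀ x y → rel S x x ≡ rel S y y
  rel-diag x y = trans (from (one-diag S x x) refl) (sym (from (one-diag S y y) refl))

  successor : ∀ s x → ∃[ y ] rel S x y ≡ s
  successor s x with Scheme.rel-surj S s
  ... | x₁ , y₁ , refl =
    let y , xy , _ = Path-transfer (rel-diag x₁ x) (y₁ , refl , inv-spec S x₁ y₁) in y , xy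

  predecessor : ∀ s y → ∃[ x ] rel S x y ≡ s
  predecessor s y =
    let x , yx = successor (inv S s) y
    in x , trans (inv-spec S y x) (trans (cong (inv S) yx) (inv-involutive s))

module CosetProperties {n m : ℕ} {S : Scheme n m} (N : NormalClosed S) where
  open SchemeProperties S

  InCoset-closed : ∀ x y z → InCoset S N y x → InCoset S N y z → InCoset S N x z
  InCoset-closed x y z yx yz =
    closed N _ _ _ yx yz
      (x , z , refl , from (0<interNum⇔Path _ _ x z) (y , inv-spec S y x , refl))

  one-mem : mem N (one S)
  one-mem with nonempty N
  ... | t , t∈ with Scheme.rel-surj S t
  ... | x , y , refl =
    subst (mem N) (from (one-diag S y y) refl) (InCoset-closed y x y t∈ t∈)

  InCoset-refl : ∀ x → InCoset S N x x
  InCoset-refl x = subst (mem N) (sym (from (one-diag S x x) refl)) one-mem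

  InCoset-sym : ∀ {x y} → InCoset S N x y → InCoset S N y x
  InCoset-sym {x} {y} xy = InCoset-closed y x x xy (InCoset-refl x)

  InCoset-trans : ∀ {x y z} → InCoset S N x y → InCoset S N y z → InCoset S N x z
  InCoset-trans {x} {y} {z} xy yz = InCoset-closed x y z (InCoset-sym xy) yz

  InCoset-trivial⇒≡ : (∀ t → mem N t ⇔ (t ≡ one S)) → ∀ {x y} → InCoset S N x y → x ≡ y
  InCoset-trivial⇒≡ trivial {x} {y} xy = to (one-diag S x y) (to (trivial _) xy)

  rel⇒QRel : ∀ {s a b} → rel S a b ≡ s → QRel S N s a b
  rel⇒QRel {a = a} {b} e = a , b , InCoset-refl a , InCoset-refl b , e

  QRel-resp-InCoset : ∀ {s a b a' b'} → QRel S N s a b →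
                      InCoset S N a a' → InCoset S N b b' → QRel S N s a' b'
  QRel-resp-InCoset (a₁ , b₁ , aa₁ , bb₁ , e) aa' bb' =
    a₁ , b₁ , InCoset-trans (InCoset-sym aa') aa₁ , InCoset-trans (InCoset-sym bb') bb₁ , e

  QRel-mem⇒InCoset : ∀ {s a b} → QRel S N s a b → mem N s → InCoset S N a b
  QRel-mem⇒InCoset (a₁ , b₁ , aa₁ , bb₁ , refl) s∈ =
    InCoset-trans aa₁ (InCoset-trans s∈ (InCoset-sym bb₁))

  QRel-InCoset⇒mem : ∀ {s a b} → QRel S N s a b → InCoset S N a b → mem N s
  QRel-InCoset⇒mem (a₁ , b₁ , aa₁ , bb₁ , refl) ab =
    InCoset-trans (InCoset-sym aa₁) (InCoset-trans ab bb₁)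

  -- Regularity copies the configuration a₁, a₂, b₂, b₁ witnessing that s and s' meet
  -- over (aN , bN) onto the pair (c₁ , d₁) of s lying over (cN , dN).
  QRel-transfer : ∀ {s s' a b c d} → QRel S N s a b → QRel S N s' a b →
                  QRel S N s c d → QRel S N s' c d
  QRel-transfer (a₁ , b₁ , aa₁ , bb₁ , refl) (a₂ , b₂ , aa₂ , bb₂ , refl)
                (c₁ , d₁ , cc₁ , dd₁ , e)
    with Path-transfer (sym e) (a₂ , refl , refl)
  ... | c₂ , c₁c₂≡a₁a₂ , c₂d₁ with Path-transfer (sym c₂d₁) (b₂ , refl , refl)
  ...   | d₂ , c₂d₂ , d₂d₁≡b₂b₁ =
    c₂ , d₂ , InCoset-trans cc₁ c₁c₂ , InCoset-trans dd₁ (InCoset-sym d₂d₁) , c₂d₂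
    where
    c₁c₂ : InCoset S N c₁ c₂
    c₁c₂ = subst (mem N) (sym c₁c₂≡a₁a₂) (InCoset-trans (InCoset-sym aa₁) aa₂)
    d₂d₁ : InCoset S N d₂ d₁
    d₂d₁ = subst (mem N) (sym d₂d₁≡b₂b₁) (InCoset-trans (InCoset-sym bb₂) bb₁)

module _ {n m n' m' : ℕ} {S : Scheme n m} {x₀ : Fin n} {S' : Scheme n' m'} {y₀ : Fin n'}
         (φ : Hom S x₀ S' y₀) where
  open CosetProperties (tgt φ)

  ImgH-functional : ∀ {σ τ₁ τ₂ a b} → ImgH φ σ τ₁ → ImgH φ σ τ₂ →
                    QRel S' (tgt φ) τ₁ a b → QRel S' (tgt φ) τ₂ a b
  ImgH-functional {σ} im₁ im₂ with Scheme.rel-surj S σ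
  ... | A , B , AB≡σ =
    let AB∈σ = CosetProperties.rel⇒QRel (src φ) AB≡σ
    in QRel-transfer (im₁ A B AB∈σ) (im₂ A B AB∈σ)

  ImgH-from-pair : ∀ {σ τ a b} → QRel S (src φ) σ a b →
                   QRel S' (tgt φ) τ (mapH φ a) (mapH φ b) → ImgH φ σ τ
  ImgH-from-pair {σ} {a = a} {b} ab∈σ fab∈τ A B AB∈σ =
    let _ , fab∈s , fAB∈s = hom (iso φ) a b A B (σ , ab∈σ , AB∈σ)
    in QRel-transfer fab∈s fab∈τ fAB∈s

module ActionProperties {nX mT nY mU : ℕ} {T : Scheme nX mT} {x₀ : Fin nX}
                        {U : Scheme nY mU} {y₀ : Fin nY} (Z : Action T x₀ U y₀) where

  S : (c : Fin nY) → Scheme nX (m' (ζ Z c))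
  S c = sch (ζ Z c)

  φ : ∀ a c → Hom (S a) x₀ (S c) x₀
  φ = ζhom Z

  f : Fin nY → Fin nY → Fin nX → Fin nX
  f a c = mapH (φ a c)

  α-preimage : ∀ c σ → ∃[ t ] α (ζ Z c) t ≡ σ
  α-preimage c σ = let t , αt≡σ = proj₂ (α-bij (ζ Z c)) σ in t , αt≡σ refl

  QRel-ζ-id⇔rel : ∀ c {s a b} → QRel (S c) (tgt (φ c c)) s (f c c a) b ⇔ rel (S c) a b ≡ s
  QRel-ζ-id⇔rel c {s} {a} {b} = mk⇔
    (λ (a₁ , b₁ , aa₁ , bb₁ , e) →
       trans (cong₂ (rel (S c)) (trans (sym fa≡a) (≡-of aa₁)) (≡-of bb₁)) e)
    (λ e → subst (λ a' → QRel (S c) N s a' b) (sym fa≡a) (rel⇒QRel e))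
    where
    N = tgt (φ c c)
    open CosetProperties N
    ≡-of : ∀ {x y} → InCoset (S c) N x y → x ≡ y
    ≡-of = InCoset-trivial⇒≡ (proj₁ (proj₂ (ax2 Z c)))
    fa≡a : f c c a ≡ a
    fa≡a = ≡-of (from (proj₂ (proj₂ (ax2 Z c)) a a) (InCoset-refl a))

  based-InCoset : ∀ a c → InCoset (S c) (tgt (φ a c)) (f a c x₀) x₀
  based-InCoset a c =
    from (based (iso (φ a c)) x₀) (CosetProperties.InCoset-refl (tgt (φ a c)) x₀)

  ImageOf : Fin nY → Fin nY → Fin mT → Fin mT → Set
  ImageOf a c s t = HomTau (ζ Z a) (ζ Z c) (φ a c) (_≡ s) t

  ImageOf-total : ∀ a c t → ∃[ s ] ImageOf a c s t
  ImageOf-total a c t with QIso.rel-surj (iso (φ a c)) (α (ζ Z c) t)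
  ... | σ , img with α-preimage a σ
  ...   | s , refl = s , s , refl , img

  ImageOf-transport : ∀ {a c a' c' s t} → rel U a c ≡ rel U a' c' →
                      ImageOf a c s t → ImageOf a' c' s t
  ImageOf-transport {a} {c} {a'} {c'} {s} {t} e = to (ax4 Z a c a' c' e (_≡ s) t)

  ImageOf-transfer : ∀ {a c s t₁ t₂ x y} → ImageOf a c s t₁ →
                     QRel (S c) (tgt (φ a c)) (α (ζ Z c) t₁) x y →
                     QRel (S c) (tgt (φ a c)) (α (ζ Z c) t₂) x y → ImageOf a c s t₂
  ImageOf-transfer {a} {c} (s , refl , img) xy∈t₁ xy∈t₂ =
    s , refl ,
    λ A B AB∈s → CosetProperties.QRel-transfer (tgt (φ a c)) xy∈t₁ xy∈t₂ (img A B AB∈s)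

  SameSD-ImageOf : ∀ {w a c s t₁ t₂} → rel U a c ≡ w →
                   ImageOf a c s t₁ → ImageOf a c s t₂ → SameSD Z (w , t₁) (w , t₂)
  SameSD-ImageOf {w} {a} {c} {s} ac≡w im₁ im₂ (a' , b) (c' , e) =
    mk⇔ (move im₁ im₂) (move im₂ im₁)
    where
    move : ∀ {tA tB} → ImageOf a c s tA → ImageOf a c s tB →
           InSD Z (w , tA) (a' , b) (c' , e) → InSD Z (w , tB) (a' , b) (c' , e)
    move imA imB (a'c'≡w , be∈tA)
      with ImageOf-transport (trans ac≡w (sym a'c'≡w)) imA
         | ImageOf-transport (trans ac≡w (sym a'c'≡w)) imB
    ... | _ , refl , imgA | _ , refl , imgB =
      a'c'≡w , ImgH-functional (φ a' c') imgA imgB be∈tA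

module ImageProducts {nX mT nY mU : ℕ} {T : Scheme nX mT} {x₀ : Fin nX}
                     {U : Scheme nY mU} {y₀ : Fin nY} (Z : Action T x₀ U y₀)
                     {u u₀ : Fin mU} {t₀ : Fin mT} (isImage : IsImageI Z u (u₀ , t₀))
                     (t : Fin mT) where
  open ActionProperties Z
  open SchemeProperties using (successor; predecessor)

  ui-label : u₀ ≡ u
  ui-label with Scheme.rel-surj U u
  ... | a , c , ac≡u = trans (sym (proj₁ (isImage a c ac≡u))) ac≡u

  ui-mem : ∀ {a c} → rel U a c ≡ u → mem (tgt (φ a c)) (α (ζ Z c) t₀)
  ui-mem {a} {c} ac≡u =
    CosetProperties.QRel-InCoset⇒mem (tgt (φ a c))
      (proj₂ (isImage a c ac≡u)) (based-InCoset a c)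

  [u,t]∈ui∙t̃ : InProdSD Z (u₀ , t₀) (one U , t) (u , t)
  [u,t]∈ui∙t̃ with Scheme.rel-surj U u
  ... | a , c , ac≡u with successor (S c) (α (ζ Z c) t) x₀
  ...   | x , x₀x≡t =
    (a , x₀) , (c , x) , (ac≡u , (x₀ , x , based-InCoset a c , InCoset-refl x , x₀x≡t)) ,
    (c , x₀) , isImage a c ac≡u ,
    (from (one-diag U c c) refl , from (QRel-ζ-id⇔rel c) x₀x≡t)
    where open CosetProperties (tgt (φ a c))

  ui∙t̃⊆[u,t] : ∀ r → InProdSD Z (u₀ , t₀) (one U , t) r → SameSD Z r (u , t)
  ui∙t̃⊆[u,t] (w , t') ((a , b) , (c' , e) , (ac'≡w , be∈t') ,
                        (c , d) , (ac≡u₀ , bd∈t₀) , (cc'≡1 , de∈t))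
    with to (one-diag U c c') cc'≡1
  ... | refl = subst (λ w → SameSD Z (w , t') (u , t)) (trans (sym ac≡u) ac'≡w)
                 (SameSD-ImageOf ac≡u (ImageOf-transfer t-image be∈t be∈t') t-image)
    where
    open CosetProperties (tgt (φ a c))
    ac≡u : rel U a c ≡ u
    ac≡u = trans ac≡u₀ ui-label
    be∈t : QRel (S c) (tgt (φ a c)) (α (ζ Z c) t) (f a c b) e
    be∈t = d , e , QRel-mem⇒InCoset bd∈t₀ (ui-mem ac≡u) , InCoset-refl e ,
           to (QRel-ζ-id⇔rel c) de∈t
    t-image : ImageOf a c (proj₁ (ImageOf-total a c t)) t
    t-image = proj₂ (ImageOf-total a c t)

  t̃∙ui-nonempty : ∃[ r ] InProdSD Z (one U , t) (u₀ , t₀) r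
  t̃∙ui-nonempty with Scheme.rel-surj U u
  ... | a , c , ac≡u with predecessor (S a) (α (ζ Z a) t) x₀
  ...   | b , bx₀≡t with α-preimage c (rel (S c) (f a c b) x₀)
  ...     | t' , αt'≡ =
    (u , t') ,
    (a , b) , (c , x₀) , (ac≡u , CosetProperties.rel⇒QRel (tgt (φ a c)) (sym αt'≡)) ,
    (a , x₀) , (from (one-diag U a a) refl , from (QRel-ζ-id⇔rel a) bx₀≡t) ,
    isImage a c ac≡u

  t̃∙ui-ImageOf : ∀ {w t'} → InProdSD Z (one U , t) (u₀ , t₀) (w , t') →
                 w ≡ u × ∃[ a ] ∃[ c ] (rel U a c ≡ u × ImageOf a c t t')
  t̃∙ui-ImageOf ((a , b) , (c' , e) , (ac'≡w , be∈t') ,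
                 (c , d) , (ac≡1 , bd∈t) , (cc'≡u₀ , de∈t₀))
    with to (one-diag U a c) ac≡1
  ... | refl =
    trans (sym ac'≡w) ac'≡u , a , c' , ac'≡u , t , refl ,
    ImgH-from-pair (φ a c')
      (CosetProperties.rel⇒QRel (src (φ a c')) (to (QRel-ζ-id⇔rel a) bd∈t))
      (QRel-resp-InCoset be∈t' (InCoset-refl _) (InCoset-sym fd-e))
    where
    open CosetProperties (tgt (φ a c'))
    ac'≡u : rel U a c' ≡ u
    ac'≡u = trans cc'≡u₀ ui-label
    fd-e : InCoset (S c') (tgt (φ a c')) (f a c' d) e
    fd-e = QRel-mem⇒InCoset de∈t₀ (ui-mem ac'≡u)

  t̃∙ui-unique : ∀ r r' → InProdSD Z (one U , t) (u₀ , t₀) r →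
                InProdSD Z (one U , t) (u₀ , t₀) r' → SameSD Z r r'
  t̃∙ui-unique (w , t₁) (w' , t₂) r∈ r'∈ with t̃∙ui-ImageOf r∈ | t̃∙ui-ImageOf r'∈
  ... | refl , a , c , ac≡u , im₁ | refl , a' , c' , a'c'≡u , im₂ =
    SameSD-ImageOf ac≡u im₁ (ImageOf-transport (trans a'c'≡u (sym ac≡u)) im₂)

proposition5p3 : ∀ {nX mT nY mU : ℕ} (T : Scheme nX mT) (x₀ : Fin nX)
                   (U : Scheme nY mU) (y₀ : Fin nY) (Z : Action T x₀ U y₀)
                   (u : Fin mU) (ui : Fin mU × Fin mT) → IsImageI Z u ui →
                   (t : Fin mT) →
                   Singleton Z (InProdSD Z ui (one U , t))
                     × Singleton Z (InProdSD Z (one U , t) ui)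
proposition5p3 T x₀ U y₀ Z u (u₀ , t₀) isImage t =
  ((u , t) , [u,t]∈ui∙t̃ , ui∙t̃⊆[u,t]) ,
  (let r , r∈ = t̃∙ui-nonempty in r , r∈ , λ r' r'∈ → t̃∙ui-unique r' r r'∈ r∈)
  where open ImageProducts Z isImage t
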